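{- Let $p$ be an odd prime, $q_p(2)=\frac{2^{p-1}-1}{p}$, and let $M_{p-2}$ be the number of permutations of $p-2$ letters that have an even number of ascents and are distinct from the identity. Then $$q_p(2)\equiv\sum_{\substack{k=1\\ k\text{ odd}}}^{p-1}\frac1k\equiv 2M_{p-2}+1\pmod p.$$
   Context: Congruences are taken in $\mathbb{Z}_p$. For a permutation $(i_1,\dots,i_n)$ of $\{1,\dots,n\}$ (mapping $j$ to $i_j$), an ascent is an index $k$ with $i_{k+1}>i_k$. -}

module Defs where

open import Data.Nat as ℕ using (ℕ; zero; suc; _∸_; _^_; _<_; _<ᵇ_)
open import Data.Nat.Divisibility using (_∣_)
open import Data.Nat.Primality using (Prime; prime⇒nonZero)
open import Data.Integer as ℤ using (ℤ; +_)
import Data.Integer.Divisibility as ℤD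
open import Data.Rational as ℚ using (ℚ; _/_; _-_; _+_; 0ℚ)
open import Data.List using (List; []; _∷_)
open import Data.Bool using (if_then_else_)
open import Relation.Nullary.Decidable using (does)
open import Data.Nat.Divisibility using (_∣?_)

-- Congruence in ℤ_p for rationals: x ≡ y (mod p) iff v_p(x - y) ≥ 1,
-- i.e. p divides the numerator of the reduced fraction x - y.
_≡_[modℚ_] : ℚ → ℚ → ℕ → Set
x ≡ y [modℚ p ] = (+ p) ℤD.∣ ℚ.numerator (x - y)

fermatQuotient2 : (p : ℕ) → Prime p → ℚ
fermatQuotient2 p pr = _/_ (+ (2 ^ (p ∸ 1) ∸ 1)) p {{prime⇒nonZero pr}}

oddHarmonic : ℕ → ℚ
oddHarmonic zero = 0ℚ
oddHarmonic (suc n) =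
  oddHarmonic n + (if does (2 ∣? suc n) then 0ℚ else (+ 1) / suc n)

ascents : List ℕ → ℕ
ascents [] = 0
ascents (x ∷ []) = 0
ascents (x ∷ y ∷ xs) = (if x <ᵇ y then 1 else 0) ℕ.+ ascents (y ∷ xs)

module Submission where

-- Write p = 2s + 3 and let 1/k be represented by kᵖ⁻² (Fermat).  Two halves:
-- (1) By the binomial theorem 2ᵖ = 2 + p ∑_j C(p, j+1)/p, so 2q ≡ ∑_j C(p, j+1)/p;
--     since C(p-1, j) ≡ (-1)ʲ, each C(p, j+1)/p ≡ (-1)ʲ/(j+1).  Pairing k with
--     p - k gives H(p-1) = ∑_{k<p} 1/k ≡ 0, and the alternating sum becomes
--     twice the sum over odd k.
-- (2) Building permutations by inserting the largest letter shows that k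
--     ascents occur A(n, k) times, A the Eulerian numbers, which satisfy
--     A(n, k) = ∑_j (-1)ʲ C(n+1, j) (k+1-j)ⁿ.  For n = p - 2 this is ≡ H(k+1), so
--     M + 1 ≡ ∑_{i ≤ s} H(2i+1), and a summation by parts yields 2M + 1 ≡ ∑_{k odd} 1/k.
-- Rationals only enter at the end, through residues of p-integral rationals.

open import Data.Bool using (Bool; true; false; if_then_else_)
open import Data.Bool.Properties using (T-≡)
open import Data.Empty using (⊥-elim)
open import Data.Integer as ℤ using (ℤ; +_; -[1+_]; _+_; _*_; -_; _-_; _^_)
import Data.Integer.Divisibility as ℤ∣ᵤ
import Data.Integer.Divisibility.Signed as ℤ∣
import Data.Integer.Properties as ℤₚ
open import Data.Integer.Tactic.RingSolver using (solve-∀)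
open import Data.List using (List; []; _∷_; map; _++_; concatMap; length; upTo; applyUpTo; filter; head)
import Data.List.Properties as Listₚ
open import Data.List.Membership.Propositional using (_∈_; _∉_)
open import Data.List.Membership.Propositional.Properties
  using (∈-map⁺; ∈-map⁻; ∈-++⁺ˡ; ∈-concat⁺′; ∈-concat⁻′; ∈-∃++; ∈-upTo⁺; ∈-upTo⁻; ∈-filter⁺; ∈-filter⁻)
open import Data.List.Membership.Propositional.Properties.WithK using (unique∧set⇒bag)
open import Data.List.Relation.Binary.BagAndSetEquality using (∼bag⇒↭)
open import Data.List.Relation.Binary.Disjoint.Propositional using (Disjoint)
open import Data.List.Relation.Binary.Permutation.Propositional using (_↭_; ↭-refl; ↭-sym; ↭-trans; ↭-prep)
open import Data.List.Relation.Binary.Permutation.Propositional.Properties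
  using (shift; drop-∷; ∈-resp-↭; ∷↭∷ʳ; ↭-length; All-resp-↭)
open import Data.List.Relation.Unary.All as All using (All; []; _∷_)
import Data.List.Relation.Unary.All.Properties as Allₚ
open import Data.List.Relation.Unary.AllPairs using ([]; _∷_)
open import Data.List.Relation.Unary.Any using (here; there)
open import Data.List.Relation.Unary.Unique.Propositional using (Unique)
import Data.List.Relation.Unary.Unique.Propositional.Properties as Uniqueₚ
open import Data.Nat as ℕ using (ℕ; zero; suc; z≤n; s≤s)
open import Data.Nat.Divisibility as ℕ∣ using (_∣_; _∣?_)
open import Data.Nat.DivMod using (_/_; m*[n/m]≡n)
open import Data.Nat.Primality using (Prime; euclidsLemma; ¬prime[0]; ¬prime[1]; prime⇒irreducible)
import Data.Nat.Properties as ℕₚ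
import Data.Nat.Tactic.RingSolver as ℕ-Ring
open import Data.Product using (_×_; _,_; proj₁; proj₂; ∃-syntax; ∃₂)
open import Data.Rational as ℚ using (ℚ; toℚᵘ)
import Data.Rational.Properties as ℚₚ
open import Data.Rational.Unnormalised using (mkℚᵘ; *≡*) renaming (_≃_ to _≃ᵘ_)
import Data.Rational.Unnormalised.Properties as ℚᵘₚ
open import Data.Sum using (_⊎_; inj₁; inj₂)
open import Function using (_∘_)
open import Function.Bundles using (_⇔_; mk⇔; Equivalence)
open import Relation.Binary.Bundles using (Setoid)
open import Relation.Binary.PropositionalEquality
import Relation.Binary.Reasoning.Setoid as SetoidReasoning
open import Relation.Nullary using (¬_; Dec; yes; no)
open import Relation.Nullary.Decidable using (does; dec-true; dec-false)

open import Defs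

pos-∸ : ∀ a b → b ℕ.≤ a → + (a ℕ.∸ b) ≡ + a - + b
pos-∸ a b b≤a = trans (sym (ℤₚ.⊖-≥ b≤a)) (sym (ℤₚ.m-n≡m⊖n a b))

pos-^ : ∀ a k → + (a ℕ.^ k) ≡ (+ a) ^ k
pos-^ a zero    = refl
pos-^ a (suc k) = trans (ℤₚ.pos-* a (a ℕ.^ k)) (cong (+ a *_) (pos-^ a k))

-- double r = 2r, by a recursion that pattern matching can follow.
double : ℕ → ℕ
double zero    = zero
double (suc r) = suc (suc (double r))

double-mono : ∀ {i j} → i ℕ.≤ j → double i ℕ.≤ double j
double-mono z≤n       = z≤n
double-mono (s≤s i≤j) = s≤s (s≤s (double-mono i≤j))

even-double : ∀ t → 2 ∣ double t
even-double t = ℕ∣.divides t (double≡ t)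
  where double≡ : ∀ t → double t ≡ t ℕ.* 2
        double≡ zero    = refl
        double≡ (suc t) = cong (suc ∘ suc) (double≡ t)

odd-double : ∀ t → ¬ (2 ∣ suc (double t))
odd-double t 2∣2t+1 with ℕ∣.∣1⇒≡1 (ℕ∣.∣m+n∣m⇒∣n (subst (2 ∣_) (ℕₚ.+-comm 1 (double t)) 2∣2t+1) (even-double t))
... | ()

parity : ∀ k → ∃[ s ] k ≡ double s ⊎ ∃[ s ] k ≡ suc (double s)
parity zero    = inj₁ (0 , refl)
parity (suc k) with parity k
... | inj₁ (s , k≡2s)   = inj₂ (s , cong suc k≡2s)
... | inj₂ (s , k≡2s+1) = inj₁ (suc s , cong suc k≡2s+1)

-- Indexing by ℕ rather
-- than Fin lets the summands be arbitrary functions ℕ → ℤ, which is how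
-- all sums of the paper (powers, binomials, Eulerian numbers) arise.
∑ : ℕ → (ℕ → ℤ) → ℤ
∑ zero    f = + 0
∑ (suc n) f = ∑ n f + f n

syntax ∑ n (λ i → e) = ∑[ i < n ] e

∑-front : ∀ n f → ∑ (suc n) f ≡ f 0 + ∑[ i < n ] f (suc i)
∑-front zero    f = ℤₚ.+-comm (+ 0) (f 0)
∑-front (suc n) f = begin
  ∑ (suc n) f + f (suc n)                       ≡⟨ cong (_+ f (suc n)) (∑-front n f) ⟩
  f 0 + ∑[ i < n ] f (suc i) + f (suc n)        ≡⟨ ℤₚ.+-assoc (f 0) _ _ ⟩
  f 0 + (∑[ i < n ] f (suc i) + f (suc n))      ∎
  where open ≡-Reasoning

∑-cong : ∀ n {f g : ℕ → ℤ} → (∀ i → i ℕ.< n → f i ≡ g i) → ∑ n f ≡ ∑ n g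
∑-cong zero    f≡g = refl
∑-cong (suc n) f≡g = cong₂ _+_ (∑-cong n (λ i i<n → f≡g i (ℕₚ.m<n⇒m<1+n i<n))) (f≡g n ℕₚ.≤-refl)

∑-+ : ∀ n (f g : ℕ → ℤ) → ∑[ i < n ] (f i + g i) ≡ ∑ n f + ∑ n g
∑-+ zero    f g = refl
∑-+ (suc n) f g = trans (cong (_+ (f n + g n)) (∑-+ n f g)) (swap (∑ n f) (∑ n g) (f n) (g n))
  where swap : ∀ a b c d → (a + b) + (c + d) ≡ (a + c) + (b + d)
        swap = solve-∀

∑-* : ∀ n c (f : ℕ → ℤ) → ∑[ i < n ] (c * f i) ≡ c * ∑ n f
∑-* zero    c f = sym (ℤₚ.*-zeroʳ c)
∑-* (suc n) c f = trans (cong (_+ c * f n) (∑-* n c f)) (sym (ℤₚ.*-distribˡ-+ c (∑ n f) (f n)))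

∑-neg : ∀ n f → ∑[ i < n ] (- f i) ≡ - ∑ n f
∑-neg zero    f = refl
∑-neg (suc n) f = trans (cong (_+ - f n) (∑-neg n f)) (sym (ℤₚ.neg-distrib-+ (∑ n f) (f n)))

∑-const : ∀ n c → ∑[ i < n ] c ≡ + n * c
∑-const zero    c = sym (ℤₚ.*-zeroˡ c)
∑-const (suc n) c = begin
  ∑[ i < n ] c + c       ≡⟨ cong (_+ c) (∑-const n c) ⟩
  + n * c + c            ≡⟨ cong (_+_ (+ n * c)) (sym (ℤₚ.*-identityˡ c)) ⟩
  + n * c + + 1 * c      ≡⟨ sym (ℤₚ.*-distribʳ-+ c (+ n) (+ 1)) ⟩
  (+ n + + 1) * c        ≡⟨ cong (_* c) (ℤₚ.+-comm (+ n) (+ 1)) ⟩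
  + suc n * c            ∎
  where open ≡-Reasoning

∑-reverse : ∀ n f → ∑ n f ≡ ∑[ i < n ] f (n ℕ.∸ suc i)
∑-reverse zero    f = refl
∑-reverse (suc n) f = begin
  ∑ n f + f n                                   ≡⟨ cong (_+ f n) (∑-reverse n f) ⟩
  ∑[ i < n ] f (n ℕ.∸ suc i) + f n              ≡⟨ ℤₚ.+-comm _ (f n) ⟩
  f n + ∑[ i < n ] f (n ℕ.∸ suc i)              ≡⟨ sym (∑-front n (λ i → f (suc n ℕ.∸ suc i))) ⟩
  ∑[ i < suc n ] f (suc n ℕ.∸ suc i)            ∎
  where open ≡-Reasoning

∑-pairs : ∀ r f → ∑ (double r) f ≡ ∑[ i < r ] (f (double i) + f (suc (double i)))
∑-pairs zero    f = refl
∑-pairs (suc r) f =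
  trans (ℤₚ.+-assoc (∑ (double r) f) (f (double r)) (f (suc (double r))))
        (cong (_+ (f (double r) + f (suc (double r)))) (∑-pairs r f))

module Congruence (p : ℕ) where

  -- a ≈ b means p ∣ a - b.  It is a record so that a and b can be
  -- recovered from a proof, which keeps the reasoning combinators inferable.
  infix 4 _≈_
  record _≈_ (a b : ℤ) : Set where
    constructor mk≈
    field p∣a-b : + p ℤ∣.∣ (a - b)

  private
    diff-self : ∀ a → a - a ≡ + 0
    diff-self = solve-∀
    diff-swap : ∀ a b → b - a ≡ - (a - b)
    diff-swap = solve-∀
    diff-chain : ∀ a b c → a - c ≡ (a - b) + (b - c)
    diff-chain = solve-∀
    diff-+ : ∀ a b c d → (a + c) - (b + d) ≡ (a - b) + (c - d)
    diff-+ = solve-∀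
    diff-* : ∀ a b c d → (a * c) - (b * d) ≡ c * (a - b) + b * (c - d)
    diff-* = solve-∀
    diff-neg : ∀ a b → (- a) - (- b) ≡ - (a - b)
    diff-neg = solve-∀
    diff-0 : ∀ a → a - + 0 ≡ a
    diff-0 = solve-∀

    p∣_ : ℤ → Set
    p∣ z = + p ℤ∣.∣ z

  ≈-reflexive : ∀ {a b} → a ≡ b → a ≈ b
  ≈-reflexive {a} refl = mk≈ (subst p∣_ (sym (diff-self a)) (ℤ∣.divides (+ 0) refl))

  ≈-refl : ∀ {a} → a ≈ a
  ≈-refl = ≈-reflexive refl

  ≈-sym : ∀ {a b} → a ≈ b → b ≈ a
  ≈-sym {a} {b} (mk≈ h) = mk≈ (subst p∣_ (sym (diff-swap a b)) (ℤ∣.∣m⇒∣-m h))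

  ≈-trans : ∀ {a b c} → a ≈ b → b ≈ c → a ≈ c
  ≈-trans {a} {b} {c} (mk≈ h) (mk≈ k) = mk≈ (subst p∣_ (sym (diff-chain a b c)) (ℤ∣.∣m∣n⇒∣m+n h k))

  ≈-setoid : Setoid _ _
  ≈-setoid = record
    { Carrier = ℤ ; _≈_ = _≈_
    ; isEquivalence = record { refl = ≈-refl ; sym = ≈-sym ; trans = ≈-trans } }

  module ≈-Reasoning = SetoidReasoning ≈-setoid

  ≈-+ : ∀ {a b c d} → a ≈ b → c ≈ d → a + c ≈ b + d
  ≈-+ {a} {b} {c} {d} (mk≈ h) (mk≈ k) = mk≈ (subst p∣_ (sym (diff-+ a b c d)) (ℤ∣.∣m∣n⇒∣m+n h k))

  ≈-* : ∀ {a b c d} → a ≈ b → c ≈ d → a * c ≈ b * d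
  ≈-* {a} {b} {c} {d} (mk≈ h) (mk≈ k) =
    mk≈ (subst p∣_ (sym (diff-* a b c d)) (ℤ∣.∣m∣n⇒∣m+n (ℤ∣.∣n⇒∣m*n c h) (ℤ∣.∣n⇒∣m*n b k)))

  ≈-neg : ∀ {a b} → a ≈ b → - a ≈ - b
  ≈-neg {a} {b} (mk≈ h) = mk≈ (subst p∣_ (sym (diff-neg a b)) (ℤ∣.∣m⇒∣-m h))

  ≈-^ : ∀ {a b} n → a ≈ b → a ^ n ≈ b ^ n
  ≈-^ zero    a≈b = ≈-refl
  ≈-^ (suc n) a≈b = ≈-* a≈b (≈-^ n a≈b)

  ≈-∑ : ∀ n {f g : ℕ → ℤ} → (∀ i → i ℕ.< n → f i ≈ g i) → ∑ n f ≈ ∑ n g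
  ≈-∑ zero    f≈g = ≈-refl
  ≈-∑ (suc n) f≈g = ≈-+ (≈-∑ n (λ i i<n → f≈g i (ℕₚ.m<n⇒m<1+n i<n))) (f≈g n ℕₚ.≤-refl)

  ∣⇒≈0 : ∀ {a} → p∣ a → a ≈ + 0
  ∣⇒≈0 {a} h = mk≈ (subst p∣_ (sym (diff-0 a)) h)

  ≈0⇒∣ : ∀ {a} → a ≈ + 0 → p∣ a
  ≈0⇒∣ {a} (mk≈ h) = subst p∣_ (diff-0 a) h

  complement : ∀ a b → a ℕ.+ b ≡ p → + a ≈ - + b
  complement a b a+b≡p = mk≈ (ℤ∣.divides (+ 1) (begin
    + a - - + b     ≡⟨ cong (_+_ (+ a)) (ℤₚ.neg-involutive (+ b)) ⟩
    + a + + b       ≡⟨ sym (ℤₚ.pos-+ a b) ⟩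
    + (a ℕ.+ b)     ≡⟨ cong +_ a+b≡p ⟩
    + p             ≡⟨ sym (ℤₚ.*-identityˡ (+ p)) ⟩
    + 1 * + p       ∎))
    where open ≡-Reasoning

  cancel : Prime p → ∀ c {a b} → ¬ (p ∣ ℤ.∣ c ∣) → c * a ≈ c * b → a ≈ b
  cancel pr c {a} {b} p∤c (mk≈ h)
    with euclidsLemma ℤ.∣ c ∣ ℤ.∣ a - b ∣ pr
           (subst (p ∣_) (ℤₚ.abs-* c (a - b)) (ℤ∣.∣⇒∣ᵤ (subst p∣_ (factor c a b) h)))
    where factor : ∀ c a b → c * a - c * b ≡ c * (a - b)
          factor = solve-∀
  ... | inj₁ p∣c   = ⊥-elim (p∤c p∣c)
  ... | inj₂ p∣a-b = mk≈ (ℤ∣.∣ᵤ⇒∣ p∣a-b)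

∤-below : ∀ {p} k → suc k ℕ.< p → ¬ (p ∣ suc k)
∤-below k k<p p∣k = ℕₚ.<⇒≱ k<p (ℕ∣.∣⇒≤ p∣k)

C : ℕ → ℕ → ℕ
C _       zero    = 1
C zero    (suc k) = 0
C (suc n) (suc k) = C n k ℕ.+ C n (suc k)

C-vanish : ∀ n k → n ℕ.< k → C n k ≡ 0
C-vanish zero    (suc k) _          = refl
C-vanish (suc n) (suc k) (s≤s n<k) =
  cong₂ ℕ._+_ (C-vanish n k n<k) (C-vanish n (suc k) (ℕₚ.m<n⇒m<1+n n<k))

C-diag : ∀ n → C n n ≡ 1
C-diag zero    = refl
C-diag (suc n) = cong₂ ℕ._+_ (C-diag n) (C-vanish n (suc n) ℕₚ.≤-refl)

C-absorb : ∀ m j → suc j ℕ.* C (suc m) (suc j) ≡ suc m ℕ.* C m j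
C-absorb zero    zero    = refl
C-absorb zero    (suc j) = ℕₚ.*-zeroʳ (suc (suc j))
C-absorb (suc m) zero    =
  trans (ℕₚ.*-identityˡ _) (cong suc (trans (sym (ℕₚ.*-identityˡ _)) (C-absorb m zero)))
C-absorb (suc m) (suc j) = begin
  suc (suc j) ℕ.* (X ℕ.+ Z)                                  ≡⟨ regroup j X Z ⟩
  suc j ℕ.* X ℕ.+ X ℕ.+ suc (suc j) ℕ.* Z                    ≡⟨ cong₂ (λ a b → a ℕ.+ X ℕ.+ b)
                                                                     (C-absorb m j) (C-absorb m (suc j)) ⟩
  suc m ℕ.* C m j ℕ.+ (C m j ℕ.+ C m (suc j)) ℕ.+ suc m ℕ.* C m (suc j)
                                                             ≡⟨ collect m (C m j) (C m (suc j)) ⟩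
  suc (suc m) ℕ.* X                                          ∎
  where
    open ≡-Reasoning
    X = C (suc m) (suc j)
    Z = C (suc m) (suc (suc j))
    regroup : ∀ j X Z → suc (suc j) ℕ.* (X ℕ.+ Z) ≡ suc j ℕ.* X ℕ.+ X ℕ.+ suc (suc j) ℕ.* Z
    regroup = ℕ-Ring.solve-∀
    collect : ∀ m U V → suc m ℕ.* U ℕ.+ (U ℕ.+ V) ℕ.+ suc m ℕ.* V ≡ suc (suc m) ℕ.* (U ℕ.+ V)
    collect = ℕ-Ring.solve-∀

-- (j+1) C(m, j+1) + j C(m, j) = m C(m, j); the form in which absorption
-- enters the recurrence for Eulerian numbers.
C-weighted : ∀ m j → suc j ℕ.* C m (suc j) ℕ.+ j ℕ.* C m j ≡ m ℕ.* C m j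
C-weighted zero    zero    = refl
C-weighted zero    (suc j) = cong₂ ℕ._+_ (ℕₚ.*-zeroʳ (suc (suc j))) (ℕₚ.*-zeroʳ (suc j))
C-weighted (suc m) zero    = trans (ℕₚ.+-identityʳ _) (C-absorb m zero)
C-weighted (suc m) (suc j) = begin
  suc (suc j) ℕ.* C (suc m) (suc (suc j)) ℕ.+ suc j ℕ.* C (suc m) (suc j)
                                           ≡⟨ cong₂ ℕ._+_ (C-absorb m (suc j)) (C-absorb m j) ⟩
  suc m ℕ.* C m (suc j) ℕ.+ suc m ℕ.* C m j ≡⟨ sym (ℕₚ.*-distribˡ-+ (suc m) (C m (suc j)) (C m j)) ⟩
  suc m ℕ.* (C m (suc j) ℕ.+ C m j)         ≡⟨ cong (suc m ℕ.*_) (ℕₚ.+-comm (C m (suc j)) (C m j)) ⟩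
  suc m ℕ.* C (suc m) (suc j)               ∎
  where open ≡-Reasoning

binomial-theorem : ∀ (a : ℤ) n → (a + + 1) ^ n ≡ ∑[ j < suc n ] (+ C n j * a ^ j)
binomial-theorem a zero    = refl
binomial-theorem a (suc n) = sym (begin
  ∑[ j < suc (suc n) ] (+ C (suc n) j * a ^ j)
    ≡⟨ ∑-front (suc n) _ ⟩
  + 1 * + 1 + ∑[ j < suc n ] (+ (C n j ℕ.+ C n (suc j)) * a ^ suc j)
    ≡⟨ cong (_+_ (+ 1 * + 1)) (trans (∑-cong (suc n) (λ j _ → split (C n j) (C n (suc j)) (a ^ suc j)))
                                  (∑-+ (suc n) lower upper)) ⟩
  + 1 * + 1 + (∑ (suc n) lower + ∑ (suc n) upper)
    ≡⟨ rotate (+ 1 * + 1) (∑ (suc n) lower) (∑ (suc n) upper) ⟩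
  ∑ (suc n) lower + (+ 1 * + 1 + ∑ (suc n) upper)
    ≡⟨ cong₂ _+_ (trans (∑-cong (suc n) (λ j _ → pull-a (+ C n j) a (a ^ j))) (∑-* (suc n) a term))
                 (sym (∑-front (suc n) term)) ⟩
  a * S + ∑ (suc (suc n)) term
    ≡⟨ cong (λ c → a * S + (S + + c * a ^ suc n)) (C-vanish n (suc n) ℕₚ.≤-refl) ⟩
  a * S + (S + + 0 * a ^ suc n)
    ≡⟨ factor a S (a ^ suc n) ⟩
  (a + + 1) * S
    ≡⟨ cong ((a + + 1) *_) (sym (binomial-theorem a n)) ⟩
  (a + + 1) ^ suc n ∎)
  where
    open ≡-Reasoning
    term lower upper : ℕ → ℤ
    term  j = + C n j * a ^ j
    lower j = + C n j * a ^ suc j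
    upper j = + C n (suc j) * a ^ suc j
    S = ∑ (suc n) term
    split : ∀ x y t → + (x ℕ.+ y) * t ≡ + x * t + + y * t
    split x y t = trans (cong (_* t) (ℤₚ.pos-+ x y)) (ℤₚ.*-distribʳ-+ t (+ x) (+ y))
    rotate : ∀ a b c → a + (b + c) ≡ b + (a + c)
    rotate = solve-∀
    pull-a : ∀ c a t → c * (a * t) ≡ a * (c * t)
    pull-a = solve-∀
    factor : ∀ a s t → a * s + (s + + 0 * t) ≡ (a + + 1) * s
    factor = solve-∀

sgn : ℕ → ℤ
sgn j = -[1+ 0 ] ^ j

sgn-square : ∀ j → sgn j * sgn j ≡ + 1
sgn-square zero    = refl
sgn-square (suc j) = trans (flip (sgn j)) (sgn-square j)
  where flip : ∀ x → (-[1+ 0 ] * x) * (-[1+ 0 ] * x) ≡ x * x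
        flip = solve-∀

sgn-even : ∀ i → sgn (double i) ≡ + 1
sgn-even zero    = refl
sgn-even (suc i) = trans (flip (sgn (double i))) (sgn-even i)
  where flip : ∀ x → -[1+ 0 ] * (-[1+ 0 ] * x) ≡ x
        flip = solve-∀

neg-odd-power : ∀ a t → (- a) ^ suc (double t) ≡ - (a ^ suc (double t))
neg-odd-power a zero    = flip a
  where flip : ∀ a → - a * + 1 ≡ - (a * + 1)
        flip = solve-∀
neg-odd-power a (suc t) = trans (cong (λ z → - a * (- a * z)) (neg-odd-power a t)) (flip a (a ^ suc (double t)))
  where flip : ∀ a x → - a * (- a * - x) ≡ - (a * (a * x))
        flip = solve-∀

module Fermat (m : ℕ) (pr : Prime (suc m)) where

  p : ℕ
  p = suc m
  open Congruence p public

  p∣C : ∀ j → suc j ℕ.< p → p ∣ C p (suc j)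
  p∣C j j<p with euclidsLemma (suc j) (C p (suc j)) pr
                   (ℕ∣.divides (C m j) (trans (C-absorb m j) (ℕₚ.*-comm p (C m j))))
  ... | inj₁ p∣j+1 = ⊥-elim (∤-below j j<p p∣j+1)
  ... | inj₂ p∣C   = p∣C

  C-p≈0 : ∀ j → suc j ℕ.< p → + C p (suc j) ≈ + 0
  C-p≈0 j j<p = ∣⇒≈0 (ℤ∣.∣ᵤ⇒∣ (p∣C j j<p))

  freshman : ∀ (a : ℤ) → (a + + 1) ^ p ≈ a ^ p + + 1
  freshman a = begin
    (a + + 1) ^ p                                ≡⟨ binomial-theorem a p ⟩
    ∑ p term + term p                            ≡⟨ cong (_+ term p) (∑-front m term) ⟩
    (term 0 + ∑[ j < m ] term (suc j)) + term p  ≈⟨ ≈-+ (≈-+ (≈-refl {term 0}) middle-vanishes) (≈-refl {term p}) ⟩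
    (term 0 + + 0) + term p                      ≡⟨ cong (λ c → (term 0 + + 0) + + c * a ^ p) (C-diag p) ⟩
    (term 0 + + 0) + + 1 * a ^ p                 ≡⟨ tidy (a ^ p) ⟩
    a ^ p + + 1                                  ∎
    where
      open ≈-Reasoning
      term : ℕ → ℤ
      term j = + C p j * a ^ j
      middle-vanishes : ∑[ j < m ] term (suc j) ≈ + 0
      middle-vanishes = ≈-trans (≈-∑ m (λ j j<m → ≈-* (C-p≈0 j (s≤s j<m)) (≈-refl {a ^ suc j})))
        (≈-reflexive (trans (∑-cong m (λ j _ → ℤₚ.*-zeroˡ (a ^ suc j))) (trans (∑-const m (+ 0)) (ℤₚ.*-zeroʳ (+ m)))))
      tidy : ∀ x → (+ 1 * + 1 + + 0) + + 1 * x ≡ x + + 1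
      tidy = solve-∀

  fermat-pow : ∀ a → (+ a) ^ p ≈ + a
  fermat-pow zero    = ≈-reflexive (ℤₚ.*-zeroˡ ((+ 0) ^ m))
  fermat-pow (suc a) = begin
    (+ suc a) ^ p       ≡⟨ cong (_^ p) (suc-as-+1 a) ⟩
    (+ a + + 1) ^ p     ≈⟨ freshman (+ a) ⟩
    (+ a) ^ p + + 1     ≈⟨ ≈-+ (fermat-pow a) ≈-refl ⟩
    + a + + 1           ≡⟨ sym (suc-as-+1 a) ⟩
    + suc a             ∎
    where
      open ≈-Reasoning
      suc-as-+1 : ∀ a → + suc a ≡ + a + + 1
      suc-as-+1 a = trans (ℤₚ.pos-+ 1 a) (ℤₚ.+-comm (+ 1) (+ a))

  fermat : ∀ k → suc k ℕ.< p → (+ suc k) ^ m ≈ + 1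
  fermat k k<p = cancel pr (+ suc k) (∤-below k k<p)
                   (≈-trans (fermat-pow (suc k)) (≈-reflexive (sym (ℤₚ.*-identityʳ (+ suc k)))))

  -- C(p-1, j) ≡ (-1)ʲ for j < p, by Pascal's rule and p ∣ C(p, j+1).
  C-pred≈sgn : ∀ j → j ℕ.< p → + C m j ≈ sgn j
  C-pred≈sgn zero    _   = ≈-refl
  C-pred≈sgn (suc j) j<p = begin
    + C m (suc j)                   ≡⟨ pascal ⟩
    + C p (suc j) + - + C m j       ≈⟨ ≈-+ (C-p≈0 j j<p) (≈-neg (C-pred≈sgn j (ℕₚ.<-trans (ℕₚ.n<1+n j) j<p))) ⟩
    + 0 + - sgn j                   ≡⟨ trans (ℤₚ.+-identityˡ _) (sym (ℤₚ.-1*i≡-i _)) ⟩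
    sgn (suc j)                     ∎
    where
      open ≈-Reasoning
      rearrange : ∀ x y → x ≡ (y + x) + - y
      rearrange = solve-∀
      pascal : + C m (suc j) ≡ + C p (suc j) + - + C m j
      pascal = trans (rearrange (+ C m (suc j)) (+ C m j))
                     (cong (_+ - + C m j) (sym (ℤₚ.pos-+ (C m j) (C m (suc j)))))

-- A n k, the number of permutations of n letters with k ascents, given
-- by its standard recurrence A(n+1, k+1) = (k+2) A(n, k+1) + (n-k) A(n, k).
-- (That this recurrence counts ascents is `ascent-distribution` below.)
A : ℕ → ℕ → ℤ
A zero    zero    = + 1
A zero    (suc k) = + 0
A (suc n) zero    = A n zero
A (suc n) (suc k) = + suc (suc k) * A n (suc k) + (+ n - + k) * A n k

A-vanish : ∀ n k → n ℕ.< k → A n k ≡ + 0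
A-vanish zero    (suc k) _         = refl
A-vanish (suc n) (suc k) (s≤s n<k) rewrite A-vanish n (suc k) (ℕₚ.m<n⇒m<1+n n<k) | A-vanish n k n<k =
  cong₂ _+_ (ℤₚ.*-zeroʳ (+ suc (suc k))) (ℤₚ.*-zeroʳ (+ n - + k))

explicit-term : ℕ → ℕ → ℕ → ℤ
explicit-term n k j = sgn j * + C (suc n) j * (+ (suc k ℕ.∸ j)) ^ n

explicit : ℕ → ℕ → ℤ
explicit n k = ∑[ j < suc k ] explicit-term n k j

private
  C-weighted-ℤ : ∀ n j → (+ j + + 1) * + C (suc n) (suc j) + + j * + C (suc n) j ≡ (+ n + + 1) * + C (suc n) j
  C-weighted-ℤ n j = begin
    (+ j + + 1) * + C (suc n) (suc j) + + j * + C (suc n) j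
      ≡⟨ cong (λ a → a * + C (suc n) (suc j) + + j * + C (suc n) j) (ℤₚ.+-comm (+ j) (+ 1)) ⟩
    + suc j * + C (suc n) (suc j) + + j * + C (suc n) j
      ≡⟨ sym (cong₂ _+_ (ℤₚ.pos-* (suc j) _) (ℤₚ.pos-* j _)) ⟩
    + (suc j ℕ.* C (suc n) (suc j)) + + (j ℕ.* C (suc n) j)
      ≡⟨ sym (ℤₚ.pos-+ (suc j ℕ.* C (suc n) (suc j)) (j ℕ.* C (suc n) j)) ⟩
    + (suc j ℕ.* C (suc n) (suc j) ℕ.+ j ℕ.* C (suc n) j)
      ≡⟨ cong +_ (C-weighted (suc n) j) ⟩
    + (suc n ℕ.* C (suc n) j)
      ≡⟨ ℤₚ.pos-* (suc n) _ ⟩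
    + suc n * + C (suc n) j
      ≡⟨ cong (_* + C (suc n) j) (ℤₚ.+-comm (+ 1) (+ n)) ⟩
    (+ n + + 1) * + C (suc n) j ∎
    where open ≡-Reasoning

  term-identity : ∀ σ e X Y J K N → (J + + 1) * X + J * Y ≡ (N + + 1) * Y →
    (-[1+ 0 ] * σ) * (Y + X) * ((K + + 1 - J) * e)
      ≡ (K + + 2) * ((-[1+ 0 ] * σ) * X * e) + (N - K) * (σ * Y * e)
  term-identity σ e X Y J K N R = begin
    (-[1+ 0 ] * σ) * (Y + X) * ((K + + 1 - J) * e)
      ≡⟨ expand σ e X Y J K N ⟩
    rhs + σ * e * (((J + + 1) * X + J * Y) - (N + + 1) * Y)
      ≡⟨ cong (λ z → rhs + σ * e * (z - (N + + 1) * Y)) R ⟩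
    rhs + σ * e * ((N + + 1) * Y - (N + + 1) * Y)
      ≡⟨ vanish rhs (σ * e) ((N + + 1) * Y) ⟩
    rhs ∎
    where
      open ≡-Reasoning
      rhs = (K + + 2) * ((-[1+ 0 ] * σ) * X * e) + (N - K) * (σ * Y * e)
      expand : ∀ σ e X Y J K N → (-[1+ 0 ] * σ) * (Y + X) * ((K + + 1 - J) * e)
        ≡ (K + + 2) * ((-[1+ 0 ] * σ) * X * e) + (N - K) * (σ * Y * e)
          + σ * e * (((J + + 1) * X + J * Y) - (N + + 1) * Y)
      expand = solve-∀
      vanish : ∀ a b c → a + b * (c - c) ≡ a
      vanish = solve-∀

explicit-term-step : ∀ n k j → j ℕ.≤ k →
  explicit-term (suc n) (suc k) (suc j)
    ≡ + suc (suc k) * explicit-term n (suc k) (suc j) + (+ n - + k) * explicit-term n k j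
explicit-term-step n k j j≤k = begin
  sgn (suc j) * + (C (suc n) j ℕ.+ C (suc n) (suc j)) * (E * E ^ n)
    ≡⟨ cong₂ (λ a b → sgn (suc j) * a * (b * E ^ n)) (ℤₚ.pos-+ (C (suc n) j) (C (suc n) (suc j))) E≡ ⟩
  (-[1+ 0 ] * sgn j) * (+ C (suc n) j + + C (suc n) (suc j)) * ((+ k + + 1 - + j) * E ^ n)
    ≡⟨ term-identity (sgn j) (E ^ n) (+ C (suc n) (suc j)) (+ C (suc n) j) (+ j) (+ k) (+ n) (C-weighted-ℤ n j) ⟩
  (+ k + + 2) * explicit-term n (suc k) (suc j) + (+ n - + k) * explicit-term n k j
    ≡⟨ cong (λ a → a * explicit-term n (suc k) (suc j) + (+ n - + k) * explicit-term n k j)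
            (sym (trans (ℤₚ.pos-+ 2 k) (ℤₚ.+-comm (+ 2) (+ k)))) ⟩
  + suc (suc k) * explicit-term n (suc k) (suc j) + (+ n - + k) * explicit-term n k j ∎
  where
    open ≡-Reasoning
    E = + (suc k ℕ.∸ j)
    E≡ : E ≡ + k + + 1 - + j
    E≡ = trans (pos-∸ (suc k) j (ℕₚ.m≤n⇒m≤1+n j≤k)) (cong (_- + j) (trans (ℤₚ.pos-+ 1 k) (ℤₚ.+-comm (+ 1) (+ k))))

∑-combine : ∀ n c d (f g : ℕ → ℤ) →
  c * ∑ (suc n) f + d * ∑ n g ≡ c * f 0 + ∑[ j < n ] (c * f (suc j) + d * g j)
∑-combine n c d f g = begin
  c * ∑ (suc n) f + d * ∑ n g
    ≡⟨ cong (λ s → c * s + d * ∑ n g) (∑-front n f) ⟩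
  c * (f 0 + ∑[ j < n ] f (suc j)) + d * ∑ n g
    ≡⟨ distribute c d (f 0) (∑[ j < n ] f (suc j)) (∑ n g) ⟩
  c * f 0 + (c * ∑[ j < n ] f (suc j) + d * ∑ n g)
    ≡⟨ cong (_+_ (c * f 0)) (sym (cong₂ _+_ (∑-* n c (f ∘ suc)) (∑-* n d g))) ⟩
  c * f 0 + (∑[ j < n ] (c * f (suc j)) + ∑[ j < n ] (d * g j))
    ≡⟨ cong (_+_ (c * f 0)) (sym (∑-+ n _ _)) ⟩
  c * f 0 + ∑[ j < n ] (c * f (suc j) + d * g j) ∎
  where
    open ≡-Reasoning
    distribute : ∀ c d x y z → c * (x + y) + d * z ≡ c * x + (c * y + d * z)
    distribute = solve-∀

-- Explicit formula for the Eulerian numbers: the explicit sum satisfies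
-- the same recurrence and initial values.
A≡explicit : ∀ n k → A n k ≡ explicit n k
A≡explicit zero    zero    = refl
A≡explicit zero    (suc k) = sym (begin
  explicit zero (suc k)
    ≡⟨ ∑-front (suc k) _ ⟩
  + 1 * + 1 * + 1 + ∑[ j < suc k ] (sgn (suc j) * + C 1 (suc j) * + 1)
    ≡⟨ cong (_+_ (+ 1 * + 1 * + 1)) (∑-front k _) ⟩
  + 1 * + 1 * + 1 + (sgn 1 * + 1 * + 1 + ∑[ j < k ] (sgn (suc (suc j)) * + 0 * + 1))
    ≡⟨ cong (λ t → + 1 * + 1 * + 1 + (sgn 1 * + 1 * + 1 + t))
            (trans (∑-cong k (λ j _ → kill (sgn (suc (suc j))))) (∑-const k (+ 0))) ⟩
  + 1 * + 1 * + 1 + (sgn 1 * + 1 * + 1 + + k * + 0)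
    ≡⟨ cancel-pair (+ k) ⟩
  + 0 ∎)
  where
    open ≡-Reasoning
    kill : ∀ x → x * + 0 * + 1 ≡ + 0
    kill = solve-∀
    cancel-pair : ∀ k → + 1 * + 1 * + 1 + (-[1+ 0 ] * + 1 * + 1 * + 1 + k * + 0) ≡ + 0
    cancel-pair = solve-∀
A≡explicit (suc n) zero    = trans (A≡explicit n zero) (cong (_+_ (+ 0)) (first-term n))
  where
    first-term : ∀ n → + 1 * + 1 * (+ 1) ^ n ≡ + 1 * + 1 * (+ 1) ^ suc n
    first-term n = cong (+ 1 * + 1 *_) (trans (ℤₚ.^-zeroˡ n) (sym (ℤₚ.^-zeroˡ (suc n))))
A≡explicit (suc n) (suc k) = begin
  + suc (suc k) * A n (suc k) + (+ n - + k) * A n k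
    ≡⟨ cong₂ (λ a b → + suc (suc k) * a + (+ n - + k) * b) (A≡explicit n (suc k)) (A≡explicit n k) ⟩
  + suc (suc k) * explicit n (suc k) + (+ n - + k) * explicit n k
    ≡⟨ ∑-combine (suc k) (+ suc (suc k)) (+ n - + k) (explicit-term n (suc k)) (explicit-term n k) ⟩
  + suc (suc k) * explicit-term n (suc k) 0
    + ∑[ j < suc k ] (+ suc (suc k) * explicit-term n (suc k) (suc j) + (+ n - + k) * explicit-term n k j)
    ≡⟨ cong₂ _+_ (first-term (+ suc (suc k)) ((+ suc (suc k)) ^ n))
                 (∑-cong (suc k) (λ j j<k+1 → sym (explicit-term-step n k j (ℕₚ.≤-pred j<k+1)))) ⟩
  explicit-term (suc n) (suc k) 0 + ∑[ j < suc k ] explicit-term (suc n) (suc k) (suc j)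
    ≡⟨ sym (∑-front (suc k) (explicit-term (suc n) (suc k))) ⟩
  explicit (suc n) (suc k) ∎
  where
    open ≡-Reasoning
    first-term : ∀ a b → a * (+ 1 * + 1 * b) ≡ + 1 * + 1 * (a * b)
    first-term = solve-∀

eulerian-sum : ℕ → (ℕ → ℤ) → ℤ
eulerian-sum n f = ∑[ k < suc n ] (A n k * f k)

eulerian-sum-step : ∀ n f →
  eulerian-sum (suc n) f ≡ eulerian-sum n (λ k → + suc k * f k + (+ n - + k) * f (suc k))
eulerian-sum-step n f = begin
  eulerian-sum (suc n) f
    ≡⟨ ∑-front (suc n) (λ k → A (suc n) k * f k) ⟩
  A n 0 * f 0 + ∑[ k < suc n ] (A (suc n) (suc k) * f (suc k))
    ≡⟨ cong (_+_ (A n 0 * f 0)) (trans (∑-cong (suc n) (λ k _ → split (+ suc (suc k)) (A n (suc k)) (+ n - + k) (A n k) (f (suc k))))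
                                       (∑-+ (suc n) up down)) ⟩
  A n 0 * f 0 + (∑ (suc n) up + ∑ (suc n) down)
    ≡⟨ sym (ℤₚ.+-assoc (A n 0 * f 0) _ _) ⟩
  A n 0 * f 0 + ∑ (suc n) up + ∑ (suc n) down
    ≡⟨ cong (λ a → A n 0 * a + ∑ (suc n) up + ∑ (suc n) down) (sym (ℤₚ.*-identityˡ (f 0))) ⟩
  stay 0 + ∑ (suc n) up + ∑ (suc n) down
    ≡⟨ cong (_+ ∑ (suc n) down) (sym (∑-front (suc n) stay)) ⟩
  ∑ (suc n) stay + stay (suc n) + ∑ (suc n) down
    ≡⟨ cong (λ a → ∑ (suc n) stay + a * (+ suc (suc n) * f (suc n)) + ∑ (suc n) down) (A-vanish n (suc n) ℕₚ.≤-refl) ⟩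
  ∑ (suc n) stay + + 0 * (+ suc (suc n) * f (suc n)) + ∑ (suc n) down
    ≡⟨ cong (_+ ∑ (suc n) down) (ℤₚ.+-identityʳ (∑ (suc n) stay)) ⟩
  ∑ (suc n) stay + ∑ (suc n) down
    ≡⟨ sym (trans (∑-cong (suc n) (λ k _ → ℤₚ.*-distribˡ-+ (A n k) _ _)) (∑-+ (suc n) stay down)) ⟩
  eulerian-sum n (λ k → + suc k * f k + (+ n - + k) * f (suc k)) ∎
  where
    open ≡-Reasoning
    up down stay : ℕ → ℤ
    up   k = A n (suc k) * (+ suc (suc k) * f (suc k))
    down k = A n k * ((+ n - + k) * f (suc k))
    stay k = A n k * (+ suc k * f k)
    split : ∀ x y z w v → (x * y + z * w) * v ≡ y * (x * v) + w * (z * v)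
    split = solve-∀

insertions : ℕ → List ℕ → List (List ℕ)
insertions x []       = (x ∷ []) ∷ []
insertions x (y ∷ ys) = (x ∷ y ∷ ys) ∷ map (y ∷_) (insertions x ys)

-- The permutations of 0, 1, …, n-1 as lists: insert n-1 in every
-- possible position of every permutation of 0, …, n-2.
perms : ℕ → List (List ℕ)
perms zero    = [] ∷ []
perms (suc n) = concatMap (insertions n) (perms n)

∈-insertions⁺ : ∀ x as bs → as ++ x ∷ bs ∈ insertions x (as ++ bs)
∈-insertions⁺ x []       []       = here refl
∈-insertions⁺ x []       (b ∷ bs) = here refl
∈-insertions⁺ x (a ∷ as) bs       = there (∈-map⁺ (a ∷_) (∈-insertions⁺ x as bs))

∈-insertions⁻ : ∀ x ys {zs} → zs ∈ insertions x ys → ∃₂ λ as bs → ys ≡ as ++ bs × zs ≡ as ++ x ∷ bs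
∈-insertions⁻ x []       (here refl) = [] , [] , refl , refl
∈-insertions⁻ x (y ∷ ys) (here refl) = [] , y ∷ ys , refl , refl
∈-insertions⁻ x (y ∷ ys) (there zs∈) with ∈-map⁻ (y ∷_) zs∈
... | w , w∈ , refl with ∈-insertions⁻ x ys w∈
...   | as , bs , refl , refl = y ∷ as , bs , refl , refl

split-at-unique : ∀ (x : ℕ) as as' {bs bs'} → x ∉ as → x ∉ as' →
                  as ++ x ∷ bs ≡ as' ++ x ∷ bs' → as ≡ as' × bs ≡ bs'
split-at-unique x []       []         _    _     refl = refl , refl
split-at-unique x []       (a' ∷ as') _    x∉as' eq with cong head eq
... | refl = ⊥-elim (x∉as' (here refl))
split-at-unique x (a ∷ as) []         x∉as _     eq with cong head eq
... | refl = ⊥-elim (x∉as (here refl))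
split-at-unique x (a ∷ as) (a' ∷ as') x∉as x∉as' eq with Listₚ.∷-injective eq
... | refl , eq' with split-at-unique x as as' (x∉as ∘ there) (x∉as' ∘ there) eq'
...   | refl , refl = refl , refl

insertions-injective : ∀ x ys ys' {zs} → x ∉ ys → x ∉ ys' →
                       zs ∈ insertions x ys → zs ∈ insertions x ys' → ys ≡ ys'
insertions-injective x ys ys' x∉ys x∉ys' zs∈ zs∈'
  with ∈-insertions⁻ x ys zs∈ | ∈-insertions⁻ x ys' zs∈'
... | as , bs , refl , refl | as' , bs' , refl , eq
  with split-at-unique x as as' (x∉ys ∘ ∈-++⁺ˡ) (x∉ys' ∘ ∈-++⁺ˡ) eq
...   | refl , refl = refl

insertions-unique : ∀ x ys → x ∉ ys → Unique (insertions x ys)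
insertions-unique x []       _    = [] ∷ []
insertions-unique x (y ∷ ys) x∉ys =
  All.tabulate first-differs ∷ Uniqueₚ.map⁺ (λ eq → proj₂ (Listₚ.∷-injective eq)) (insertions-unique x ys (x∉ys ∘ there))
  where
    first-differs : ∀ {w} → w ∈ map (y ∷_) (insertions x ys) → (x ∷ y ∷ ys) ≢ w
    first-differs w∈ eq with ∈-map⁻ (y ∷_) w∈
    ... | _ , _ , refl = x∉ys (here (proj₁ (Listₚ.∷-injective eq)))

upTo-suc : ∀ n → n ∷ upTo n ↭ upTo (suc n)
upTo-suc n = subst (n ∷ upTo n ↭_) (Listₚ.upTo-∷ʳ n) (∷↭∷ʳ n (upTo n))

perms-sound : ∀ n {zs} → zs ∈ perms n → zs ↭ upTo n
perms-sound zero    (here refl) = ↭-refl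
perms-sound (suc n) zs∈ with ∈-concat⁻′ (map (insertions n) (perms n)) zs∈
... | xs , zs∈xs , xs∈ with ∈-map⁻ (insertions n) xs∈
...   | ys , ys∈ , refl with ∈-insertions⁻ n ys zs∈xs
...     | as , bs , refl , refl =
  ↭-trans (shift n as bs) (↭-trans (↭-prep n (perms-sound n ys∈)) (upTo-suc n))

perms-complete : ∀ n {zs} → zs ↭ upTo n → zs ∈ perms n
perms-complete zero    {[]}     _ = here refl
perms-complete zero    {z ∷ zs} π with ↭-length π
... | ()
perms-complete (suc n) {zs} π with ∈-∃++ (∈-resp-↭ (↭-sym π) (∈-upTo⁺ {suc n} {n} ℕₚ.≤-refl))
... | as , bs , refl = ∈-concat⁺′ (∈-insertions⁺ n as bs) (∈-map⁺ (insertions n) (perms-complete n π′))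
  where
    π′ : as ++ bs ↭ upTo n
    π′ = drop-∷ (↭-trans (↭-sym (shift n as bs)) (↭-trans π (↭-sym (upTo-suc n))))

∉-perm : ∀ {n ys} → ys ↭ upTo n → n ∉ ys
∉-perm π n∈ys = ℕₚ.<-irrefl refl (∈-upTo⁻ (∈-resp-↭ π n∈ys))

insertions-concat-unique : ∀ x Ps → Unique Ps → (∀ {ys} → ys ∈ Ps → x ∉ ys) → Unique (concatMap (insertions x) Ps)
insertions-concat-unique x []       []            _       = []
insertions-concat-unique x (ys ∷ Ps) (ys∉Ps ∷ uPs) x∉Ps =
  Uniqueₚ.++⁺ (insertions-unique x ys (x∉Ps (here refl)))
              (insertions-concat-unique x Ps uPs (x∉Ps ∘ there))
              disjoint
  where
    disjoint : Disjoint (insertions x ys) (concatMap (insertions x) Ps)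
    disjoint (zs∈ , zs∈rest) with ∈-concat⁻′ (map (insertions x) Ps) zs∈rest
    ... | xs , zs∈xs , xs∈ with ∈-map⁻ (insertions x) xs∈
    ...   | ys' , ys'∈ , refl =
      All.lookup ys∉Ps ys'∈ (insertions-injective x ys ys' (x∉Ps (here refl)) (x∉Ps (there ys'∈)) zs∈ zs∈xs)

perms-unique : ∀ n → Unique (perms n)
perms-unique zero    = [] ∷ []
perms-unique (suc n) = insertions-concat-unique n (perms n) (perms-unique n) (∉-perm ∘ perms-sound n)

bit : Bool → ℕ
bit b = if b then 1 else 0

<ᵇ-true : ∀ {x y} → x ℕ.< y → (x ℕ.<ᵇ y) ≡ true
<ᵇ-true x<y = Equivalence.to T-≡ (ℕₚ.<⇒<ᵇ x<y)

<ᵇ-false : ∀ {x y} → y ℕ.< x → (x ℕ.<ᵇ y) ≡ false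
<ᵇ-false {x} {y} y<x with x ℕ.<ᵇ y in eq
... | false = refl
... | true  = ⊥-elim (ℕₚ.<-asym y<x (ℕₚ.<ᵇ⇒< x y (Equivalence.from T-≡ eq)))

ascent-sum : List (List ℕ) → (ℕ → ℤ) → ℤ
ascent-sum []       f = + 0
ascent-sum (zs ∷ S) f = f (ascents zs) + ascent-sum S f

ascent-sum-++ : ∀ S S' f → ascent-sum (S ++ S') f ≡ ascent-sum S f + ascent-sum S' f
ascent-sum-++ []       S' f = sym (ℤₚ.+-identityˡ _)
ascent-sum-++ (zs ∷ S) S' f =
  trans (cong (_+_ (f (ascents zs))) (ascent-sum-++ S S' f)) (sym (ℤₚ.+-assoc (f (ascents zs)) _ _))

ascent-sum-prefix : ∀ y y' U f →
  ascent-sum (map (y ∷_) (map (y' ∷_) U)) f ≡ ascent-sum (map (y' ∷_) U) (λ a → f (bit (y ℕ.<ᵇ y') ℕ.+ a))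
ascent-sum-prefix y y' []      f = refl
ascent-sum-prefix y y' (u ∷ U) f = cong (_+_ (f (bit (y ℕ.<ᵇ y') ℕ.+ ascents (y' ∷ u)))) (ascent-sum-prefix y y' U f)

-- Inserting a new maximum into a list with a ascents and L letters:
-- a + 1 of the L + 1 positions keep a ascents, the other L - a create one.
insertion-weight : ℕ → ℕ → (ℕ → ℤ) → ℤ
insertion-weight a L f = + suc a * f a + (+ L - + a) * f (suc a)

-- The arithmetic of one inductive step of `ascent-sum-insertions`: b
-- records whether the new first letter is an ascent.
insertion-weight-step : ∀ b a L f →
  f (suc a) + insertion-weight a L (λ k → f (bit b ℕ.+ k)) ≡ insertion-weight (bit b ℕ.+ a) (suc L) f
insertion-weight-step false a L f =
  trans (regroup (f (suc a)) (f a) (+ suc a) (+ a) (+ L))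
        (cong (λ l → + suc a * f a + (l - + a) * f (suc a)) (sym (ℤₚ.pos-+ 1 L)))
  where regroup : ∀ x y S A L → x + (S * y + (L - A) * x) ≡ S * y + ((+ 1 + L) - A) * x
        regroup = solve-∀
insertion-weight-step true  a L f =
  trans (regroup (f (suc a)) (f (suc (suc a))) (+ suc a) (+ a) (+ L))
        (cong₂ (λ s l → s * f (suc a) + (l - + suc a) * f (suc (suc a)))
               (sym (ℤₚ.pos-+ 1 (suc a))) (sym (ℤₚ.pos-+ 1 L)))
  where regroup : ∀ x z S A L → x + (S * x + (L - A) * z) ≡ (+ 1 + S) * x + ((+ 1 + L) - (+ 1 + A)) * z
        regroup = solve-∀

ascent-sum-insertions : ∀ x ys f → All (ℕ._< x) ys →
  ascent-sum (insertions x ys) f ≡ insertion-weight (ascents ys) (length ys) f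
ascent-sum-insertions x [] f _ = tidy (f 0) (f 1)
  where tidy : ∀ u v → u + + 0 ≡ + 1 * u + (+ 0 - + 0) * v
        tidy = solve-∀
ascent-sum-insertions x (y ∷ []) f (y<x ∷ []) rewrite <ᵇ-false {x} {y} y<x | <ᵇ-true y<x = tidy (f 0) (f 1)
  where tidy : ∀ u v → u + (v + + 0) ≡ + 1 * u + (+ 1 - + 0) * v
        tidy = solve-∀
ascent-sum-insertions x (y ∷ y' ∷ ys) f (y<x ∷ y'<x ∷ ys<x) = begin
  f (ascents (x ∷ y ∷ y' ∷ ys)) + (f (ascents (y ∷ x ∷ y' ∷ ys)) + ascent-sum (map (y ∷_) (map (y' ∷_) (insertions x ys))) f)
    ≡⟨ cong₂ (λ u v → f u + (f v + ascent-sum (map (y ∷_) (map (y' ∷_) (insertions x ys))) f)) x-first y-x-first ⟩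
  g a' + (f (suc a') + ascent-sum (map (y ∷_) (map (y' ∷_) (insertions x ys))) f)
    ≡⟨ cong (λ t → g a' + (f (suc a') + t)) (ascent-sum-prefix y y' (insertions x ys) f) ⟩
  g a' + (f (suc a') + rest)
    ≡⟨ swap (g a') (f (suc a')) rest ⟩
  f (suc a') + (g a' + rest)
    ≡⟨ cong (λ t → f (suc a') + (g t + rest)) (sym x-second) ⟩
  f (suc a') + ascent-sum (insertions x (y' ∷ ys)) g
    ≡⟨ cong (_+_ (f (suc a'))) (ascent-sum-insertions x (y' ∷ ys) g (y'<x ∷ ys<x)) ⟩
  f (suc a') + insertion-weight a' (length (y' ∷ ys)) g
    ≡⟨ insertion-weight-step b a' (length (y' ∷ ys)) f ⟩
  insertion-weight (ascents (y ∷ y' ∷ ys)) (length (y ∷ y' ∷ ys)) f ∎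
  where
    open ≡-Reasoning
    a' = ascents (y' ∷ ys)
    b = y ℕ.<ᵇ y'
    g : ℕ → ℤ
    g k = f (bit b ℕ.+ k)
    rest = ascent-sum (map (y' ∷_) (insertions x ys)) g
    x-second : ascents (x ∷ y' ∷ ys) ≡ a'
    x-second = cong (λ c → bit c ℕ.+ a') (<ᵇ-false {x} {y'} y'<x)
    x-first : ascents (x ∷ y ∷ y' ∷ ys) ≡ ascents (y ∷ y' ∷ ys)
    x-first = cong (λ c → bit c ℕ.+ ascents (y ∷ y' ∷ ys)) (<ᵇ-false {x} {y} y<x)
    y-x-first : ascents (y ∷ x ∷ y' ∷ ys) ≡ suc a'
    y-x-first = cong₂ (λ c d → bit c ℕ.+ d) (<ᵇ-true y<x) x-second
    swap : ∀ u v w → u + (v + w) ≡ v + (u + w)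
    swap = solve-∀

perm-bounded : ∀ {n ys} → ys ↭ upTo n → All (ℕ._< n) ys
perm-bounded {n} π = All-resp-↭ (↭-sym π) (Allₚ.all-upTo n)

perm-length : ∀ {n ys} → ys ↭ upTo n → length ys ≡ n
perm-length {n} π = trans (↭-length π) (Listₚ.length-upTo n)

ascent-sum-insert-max : ∀ n Ps f → (∀ {ys} → ys ∈ Ps → ys ↭ upTo n) →
  ascent-sum (concatMap (insertions n) Ps) f ≡ ascent-sum Ps (λ a → insertion-weight a n f)
ascent-sum-insert-max n []        f _     = refl
ascent-sum-insert-max n (ys ∷ Ps) f perm = begin
  ascent-sum (insertions n ys ++ concatMap (insertions n) Ps) f
    ≡⟨ ascent-sum-++ (insertions n ys) _ f ⟩
  ascent-sum (insertions n ys) f + ascent-sum (concatMap (insertions n) Ps) f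
    ≡⟨ cong₂ _+_ (ascent-sum-insertions n ys f (perm-bounded (perm (here refl))))
                 (ascent-sum-insert-max n Ps f (perm ∘ there)) ⟩
  insertion-weight (ascents ys) (length ys) f + ascent-sum Ps (λ a → insertion-weight a n f)
    ≡⟨ cong (λ L → insertion-weight (ascents ys) L f + ascent-sum Ps (λ a → insertion-weight a n f))
            (perm-length (perm (here refl))) ⟩
  ascent-sum (ys ∷ Ps) (λ a → insertion-weight a n f) ∎
  where open ≡-Reasoning

-- The number of permutations of n letters with k ascents is A(n, k),
-- expressed for an arbitrary weight f on the number of ascents.
ascent-distribution : ∀ n f → ascent-sum (perms n) f ≡ eulerian-sum n f
ascent-distribution zero    f = trans (ℤₚ.+-identityʳ (f 0)) (sym (trans (ℤₚ.+-identityˡ _) (ℤₚ.*-identityˡ (f 0))))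
ascent-distribution (suc n) f = begin
  ascent-sum (perms (suc n)) f                              ≡⟨ ascent-sum-insert-max n (perms n) f (perms-sound n) ⟩
  ascent-sum (perms n) (λ a → insertion-weight a n f)       ≡⟨ ascent-distribution n _ ⟩
  eulerian-sum n (λ a → insertion-weight a n f)             ≡⟨ sym (eulerian-sum-step n f) ⟩
  eulerian-sum (suc n) f                                    ∎
  where open ≡-Reasoning

has-even-ascents : (zs : List ℕ) → Dec (2 ∣ ascents zs)
has-even-ascents zs = 2 ∣? ascents zs

even-indicator : ℕ → ℤ
even-indicator k = if does (2 ∣? k) then + 1 else + 0

count-even : ∀ S → + length (filter has-even-ascents S) ≡ ascent-sum S even-indicator
count-even []       = refl
count-even (zs ∷ S) with does (2 ∣? ascents zs)
... | true  = cong (_+_ (+ 1)) (count-even S)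
... | false = trans (count-even S) (sym (ℤₚ.+-identityˡ _))

ascents-upTo : ∀ k → ascents (upTo (suc k)) ≡ k
ascents-upTo k = increasing k (λ i → i) (λ i → ℕₚ.≤-refl)
  where
    increasing : ∀ k (g : ℕ → ℕ) → (∀ i → g i ℕ.< g (suc i)) → ascents (applyUpTo g (suc k)) ≡ k
    increasing zero    g g↑ = refl
    increasing (suc k) g g↑ =
      cong₂ (λ b c → bit b ℕ.+ c) (<ᵇ-true (g↑ 0)) (increasing k (g ∘ suc) (g↑ ∘ suc))

count-even-perms : ∀ n (L : List (List ℕ)) → Unique L →
  (∀ xs → xs ∈ L ⇔ ((xs ↭ upTo n) × (2 ∣ ascents xs) × (xs ≢ upTo n))) →
  2 ∣ ascents (upTo n) →
  suc (length L) ≡ length (filter has-even-ascents (perms n))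
count-even-perms n L L-unique L-spec id-even =
  ↭-length (∼bag⇒↭ (unique∧set⇒bag (id∉L ∷ L-unique) (Uniqueₚ.filter⁺ has-even-ascents (perms-unique n))
                                     (mk⇔ (to _) (from _))))
  where
    id∉L : All (upTo n ≢_) L
    id∉L = All.tabulate (λ {xs} xs∈L eq → proj₂ (proj₂ (Equivalence.to (L-spec xs) xs∈L)) (sym eq))
    to : ∀ xs → xs ∈ upTo n ∷ L → xs ∈ filter has-even-ascents (perms n)
    to xs (here refl) = ∈-filter⁺ has-even-ascents (perms-complete n ↭-refl) id-even
    to xs (there xs∈L) with Equivalence.to (L-spec xs) xs∈L
    ... | π , even , _ = ∈-filter⁺ has-even-ascents (perms-complete n π) even
    from : ∀ xs → xs ∈ filter has-even-ascents (perms n) → xs ∈ upTo n ∷ L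
    from xs xs∈ with ∈-filter⁻ has-even-ascents xs∈
    ... | xs∈perms , even with Listₚ.≡-dec ℕₚ._≟_ xs (upTo n)
    ...   | yes refl  = here refl
    ...   | no  xs≢id = there (Equivalence.from (L-spec xs) (perms-sound n xs∈perms , even , xs≢id))

module HarmonicSums (h : ℕ → ℤ) where

  -- H N = h(1) + ⋯ + h(N); for h(k) = 1/k these are the harmonic numbers.
  H : ℕ → ℤ
  H N = ∑[ i < N ] h (suc i)

  H-odd-sum weighted-sum odd-sum : ℕ → ℤ
  H-odd-sum    t = ∑[ i < suc t ] H (suc (double i))
  weighted-sum t = ∑[ k < suc (double t) ] (+ suc k * h (suc k))
  odd-sum      t = ∑[ i < suc t ] h (suc (double i))

  by-parts : ∀ t → + 2 * H-odd-sum t + weighted-sum t ≡ + double (suc t) * H (suc (double t)) + odd-sum t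
  by-parts zero    = tidy (h 1)
    where tidy : ∀ x → + 2 * (+ 0 + (+ 0 + x)) + (+ 0 + + 1 * x) ≡ + 2 * (+ 0 + x) + (+ 0 + x)
          tidy = solve-∀
  by-parts (suc t) = begin
    + 2 * (V + (Hₜ + a + b)) + ((P + + suc (suc (double t)) * a) + + suc (suc (suc (double t))) * b)
      ≡⟨ cong₂ (λ u v → + 2 * (V + (Hₜ + a + b)) + ((P + u * a) + v * b)) (ℤₚ.pos-+ 2 (double t)) (ℤₚ.pos-+ 3 (double t)) ⟩
    + 2 * (V + (Hₜ + a + b)) + ((P + (+ 2 + D) * a) + (+ 3 + D) * b)
      ≡⟨ split-off V P Hₜ a b D O ⟩
    (+ 2 * V + P) - ((+ 2 + D) * Hₜ + O) + ((+ 4 + D) * (Hₜ + a + b) + (O + b))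
      ≡⟨ cong (λ z → z - ((+ 2 + D) * Hₜ + O) + ((+ 4 + D) * (Hₜ + a + b) + (O + b)))
              (trans (by-parts t) (cong (λ z → z * Hₜ + O) (ℤₚ.pos-+ 2 (double t)))) ⟩
    ((+ 2 + D) * Hₜ + O) - ((+ 2 + D) * Hₜ + O) + ((+ 4 + D) * (Hₜ + a + b) + (O + b))
      ≡⟨ cancel ((+ 2 + D) * Hₜ + O) _ ⟩
    (+ 4 + D) * (Hₜ + a + b) + (O + b)
      ≡⟨ cong (λ z → z * (Hₜ + a + b) + (O + b)) (sym (ℤₚ.pos-+ 4 (double t))) ⟩
    + double (suc (suc t)) * H (suc (double (suc t))) + odd-sum (suc t) ∎
    where
      open ≡-Reasoning
      V = H-odd-sum t
      P = weighted-sum t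
      O = odd-sum t
      Hₜ = H (suc (double t))
      a = h (suc (suc (double t)))
      b = h (suc (suc (suc (double t))))
      D = + double t
      split-off : ∀ V P H a b D O → + 2 * (V + (H + a + b)) + ((P + (+ 2 + D) * a) + (+ 3 + D) * b)
        ≡ (+ 2 * V + P) - ((+ 2 + D) * H + O) + ((+ 4 + D) * (H + a + b) + (O + b))
      split-off = solve-∀
      cancel : ∀ x y → x - x + y ≡ y
      cancel = solve-∀

-- Residues modulo a prime p of rationals whose denominator is prime to p;
-- they reduce congruences of rationals to congruences of integers.
module Residues (p : ℕ) (pr : Prime p) where
  open Congruence p using (_≈_; ≈-refl; ≈-reflexive; ≈-sym; ≈-trans; ≈-+; ≈-*; ≈-neg; ≈0⇒∣; module ≈-Reasoning)

  record HasResidue (x : ℚ) (a : ℤ) : Set where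
    constructor residue
    field
      numer : ℤ
      denom-1 : ℕ
      x≃ : toℚᵘ x ≃ᵘ mkℚᵘ numer denom-1
      p∤denom : ¬ (p ∣ suc denom-1)
      numer≈ : numer ≈ a * + suc denom-1

  residue-+ : ∀ {x y a b} → HasResidue x a → HasResidue y b → HasResidue (x ℚ.+ y) (a + b)
  residue-+ {x} {y} {a} {b} (residue i k x≃ p∤k+1 i≈) (residue j l y≃ p∤l+1 j≈) =
    residue (i * + suc l + j * + suc k) (l ℕ.+ k ℕ.* suc l)
      (ℚᵘₚ.≃-trans (ℚₚ.toℚᵘ-homo-+ x y) (ℚᵘₚ.+-cong x≃ y≃))
      p∤product
      (begin
        i * + suc l + j * + suc k                          ≈⟨ ≈-+ (≈-* i≈ (≈-refl {+ suc l})) (≈-* j≈ (≈-refl {+ suc k})) ⟩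
        a * + suc k * + suc l + b * + suc l * + suc k      ≡⟨ common a b (+ suc k) (+ suc l) ⟩
        (a + b) * (+ suc k * + suc l)                      ≡⟨ cong ((a + b) *_) (sym (ℤₚ.pos-* (suc k) (suc l))) ⟩
        (a + b) * + suc (l ℕ.+ k ℕ.* suc l)                ∎)
    where
      open ≈-Reasoning
      common : ∀ a b s t → a * s * t + b * t * s ≡ (a + b) * (s * t)
      common = solve-∀
      p∤product : ¬ (p ∣ suc k ℕ.* suc l)
      p∤product p∣kl with euclidsLemma (suc k) (suc l) pr p∣kl
      ... | inj₁ p∣k+1 = p∤k+1 p∣k+1
      ... | inj₂ p∣l+1 = p∤l+1 p∣l+1

  residue-neg : ∀ {x a} → HasResidue x a → HasResidue (ℚ.- x) (- a)
  residue-neg {x} {a} (residue i k x≃ p∤k+1 i≈) =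
    residue (- i) k (ℚᵘₚ.≃-trans (ℚₚ.toℚᵘ-homo‿- x) (ℚᵘₚ.-‿cong x≃)) p∤k+1
      (≈-trans (≈-neg i≈) (≈-reflexive (ℤₚ.neg-distribˡ-* a (+ suc k))))

  residue-− : ∀ {x y a b} → HasResidue x a → HasResidue y b → HasResidue (x ℚ.- y) (a - b)
  residue-− x∼a y∼b = residue-+ x∼a (residue-neg y∼b)

  residue-frac : ∀ i k {a} → ¬ (p ∣ suc k) → i ≈ a * + suc k → HasResidue (i ℚ./ suc k) a
  residue-frac i k p∤k+1 i≈ = residue i k (ℚₚ.toℚᵘ-fromℚᵘ (mkℚᵘ i k)) p∤k+1 i≈

  residue-int : ∀ a → HasResidue (a ℚ./ 1) a
  residue-int a = residue-frac a 0 (λ p∣1 → ¬prime[1] (subst Prime (ℕ∣.∣1⇒≡1 p∣1) pr)) (≈-reflexive (sym (ℤₚ.*-identityʳ a)))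

  residue-inverse : ∀ k {c} → ¬ (p ∣ suc k) → c * + suc k ≈ + 1 → HasResidue ((+ 1) ℚ./ suc k) c
  residue-inverse k p∤k+1 c≈ = residue-frac (+ 1) k p∤k+1 (≈-sym c≈)

  residue-zero : ∀ {z c} → HasResidue z c → c ≈ + 0 → + p ℤ∣ᵤ.∣ ℚ.numerator z
  residue-zero {z} {c} (residue i k (*≡* z≃) p∤k+1 i≈) c≈0
    with euclidsLemma ℤ.∣ ℚ.numerator z ∣ (suc k) pr
           (subst (p ∣_) (ℤₚ.abs-* (ℚ.numerator z) (+ suc k)) (subst (λ t → p ∣ ℤ.∣ t ∣) (sym cross) p∣i·d))
    where
      cross : ℚ.numerator z * + suc k ≡ i * ℚ.denominator z
      cross = trans (cong (_* + suc k) (sym (ℚₚ.↥ᵘ-toℚᵘ z))) (trans z≃ (cong (i *_) (ℚₚ.↧ᵘ-toℚᵘ z)))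
      i≈0 : i ≈ + 0
      i≈0 = ≈-trans i≈ (≈-* c≈0 (≈-refl {+ suc k}))
      p∣i·d : p ∣ ℤ.∣ i * ℚ.denominator z ∣
      p∣i·d = ℤ∣.∣⇒∣ᵤ (ℤ∣.∣m⇒∣m*n (ℚ.denominator z) (≈0⇒∣ i≈0))
  ... | inj₁ p∣numer = p∣numer
  ... | inj₂ p∣k+1   = ⊥-elim (p∤k+1 p∣k+1)

module OddPrime (s : ℕ) (pr : Prime (suc (suc (suc (double s))))) where

  m n : ℕ
  m = suc (suc (double s))
  n = suc (double s)

  open Fermat m pr
  open Residues p pr

  -- kᵖ⁻² is the inverse of k modulo p; sums of these represent sums of 1/k.
  inv : ℕ → ℤ
  inv k = (+ k) ^ n

  open HarmonicSums inv

  inv-inverse : ∀ k → suc k ℕ.< p → + suc k * inv (suc k) ≈ + 1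
  inv-inverse = fermat

  halve : ∀ {x y} → + 2 * x ≈ + 2 * y → x ≈ y
  halve = cancel pr (+ 2) (∤-below 1 (s≤s (s≤s (s≤s z≤n))))

  -- 1/(p - b) ≡ -1/b, since p - 2 is odd.
  inv-complement : ∀ a b → a ℕ.+ b ≡ p → inv a ≈ - inv b
  inv-complement a b a+b≡p = ≈-trans (≈-^ n (complement a b a+b≡p)) (≈-reflexive (neg-odd-power (+ b) s))

  -- H(p-1) ≡ 0: the terms 1/k and 1/(p-k) cancel.
  H-full : H m ≈ + 0
  H-full = halve (begin
    + 2 * H m                               ≡⟨ double-is-sum (H m) ⟩
    H m + H m                               ≡⟨ cong (_+ H m) (∑-reverse m (inv ∘ suc)) ⟩
    ∑[ i < m ] inv (suc (m ℕ.∸ suc i)) + H m ≈⟨ ≈-+ (≈-∑ m pair-off) ≈-refl ⟩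
    ∑[ i < m ] (- inv (suc i)) + H m        ≡⟨ cong (_+ H m) (∑-neg m (inv ∘ suc)) ⟩
    - H m + H m                             ≡⟨ vanish (H m) ⟩
    + 2 * + 0                               ∎)
    where
      open ≈-Reasoning
      double-is-sum : ∀ x → + 2 * x ≡ x + x
      double-is-sum = solve-∀
      vanish : ∀ x → - x + x ≡ + 2 * + 0
      vanish = solve-∀
      pair-off : ∀ i → i ℕ.< m → inv (suc (m ℕ.∸ suc i)) ≈ - inv (suc i)
      pair-off i i<m = inv-complement (suc (m ℕ.∸ suc i)) (suc i) (cong suc (ℕₚ.m∸n+n≡m i<m))

  -- H(p-2) ≡ H(p-1) - 1/(p-1) ≡ 1.
  H-pred : H n ≈ + 1
  H-pred = begin
    H n                          ≡⟨ add-sub (H n) ⟩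
    (H n + - + 1) + + 1          ≈⟨ ≈-+ (≈-trans (≈-+ (≈-refl {H n}) (≈-sym inv-p-1)) H-full) ≈-refl ⟩
    + 0 + + 1                    ∎
    where
      open ≈-Reasoning
      add-sub : ∀ x → x ≡ (x + - + 1) + + 1
      add-sub = solve-∀
      inv-p-1 : inv m ≈ - + 1
      inv-p-1 = ≈-trans (inv-complement m 1 (ℕₚ.+-comm m 1)) (≈-neg (≈-reflexive (ℤₚ.^-zeroˡ n)))

  weighted≈ : weighted-sum s ≈ + n
  weighted≈ = ≈-trans (≈-∑ n (λ k k<n → inv-inverse k (s≤s (ℕₚ.m≤n⇒m≤1+n k<n))))
                      (≈-reflexive (trans (∑-const n (+ 1)) (ℤₚ.*-identityʳ (+ n))))

  H-odd-sum≈ : + 2 * H-odd-sum s - + 1 ≈ odd-sum s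
  H-odd-sum≈ = begin
    + 2 * H-odd-sum s - + 1
      ≡⟨ isolate (H-odd-sum s) (weighted-sum s) ⟩
    (+ 2 * H-odd-sum s + weighted-sum s) - weighted-sum s - + 1
      ≡⟨ cong (λ z → z - weighted-sum s - + 1) (by-parts s) ⟩
    (+ m * H n + odd-sum s) - weighted-sum s - + 1
      ≈⟨ ≈-+ (≈-+ (≈-+ (≈-* (complement m 1 (ℕₚ.+-comm m 1)) H-pred) ≈-refl)
                   (≈-neg (≈-trans weighted≈ (complement n 2 (ℕₚ.+-comm n 2)))))
             ≈-refl ⟩
    (- + 1 * + 1 + odd-sum s) - (- + 2) - + 1
      ≡⟨ tidy (odd-sum s) ⟩
    odd-sum s ∎
    where
      open ≈-Reasoning
      isolate : ∀ V P → + 2 * V - + 1 ≡ (+ 2 * V + P) - P - + 1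
      isolate = solve-∀
      tidy : ∀ O → (- + 1 * + 1 + O) - (- + 2) - + 1 ≡ O
      tidy = solve-∀

  -- Modulo p, A(p-2, k) ≡ H(k+1): the binomials C(p-1, j) become signs
  -- and the powers (k+1-j)ᵖ⁻² become inverses.
  explicit≈H : ∀ k → suc k ℕ.< p → explicit n k ≈ H (suc k)
  explicit≈H k k+1<p = begin
    explicit n k                              ≈⟨ ≈-∑ (suc k) sign-cancels ⟩
    ∑[ j < suc k ] inv (suc k ℕ.∸ j)          ≡⟨ ∑-reverse (suc k) (λ j → inv (suc k ℕ.∸ j)) ⟩
    ∑[ i < suc k ] inv (suc k ℕ.∸ (suc k ℕ.∸ suc i)) ≡⟨ ∑-cong (suc k) reindex ⟩
    H (suc k)                                 ∎
    where
      open ≈-Reasoning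
      sign-cancels : ∀ j → j ℕ.< suc k → explicit-term n k j ≈ inv (suc k ℕ.∸ j)
      sign-cancels j j≤k = ≈-trans (≈-* (≈-* (≈-refl {sgn j}) (C-pred≈sgn j (ℕₚ.<-trans j≤k k+1<p))) ≈-refl)
                                   (≈-reflexive (trans (cong (_* inv (suc k ℕ.∸ j)) (sgn-square j)) (ℤₚ.*-identityˡ _)))
      reindex : ∀ i → i ℕ.< suc k → inv (suc k ℕ.∸ (suc k ℕ.∸ suc i)) ≡ inv (suc i)
      reindex i (s≤s i≤k) = cong inv (trans (ℕₚ.+-∸-assoc 1 (ℕₚ.m∸n≤m k i)) (cong suc (ℕₚ.m∸[m∸n]≡n i≤k)))

  q : ℕ
  q = (2 ℕ.^ m ℕ.∸ 1) / p

  p*q : p ℕ.* q ≡ 2 ℕ.^ m ℕ.∸ 1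
  p*q = m*[n/m]≡n (ℤ∣.∣⇒∣ᵤ (≈0⇒∣ (begin
    + (2 ℕ.^ m ℕ.∸ 1)         ≡⟨ trans (pos-∸ (2 ℕ.^ m) 1 (ℕₚ.m^n>0 2 m)) (cong (_- + 1) (pos-^ 2 m)) ⟩
    (+ 2) ^ m - + 1           ≈⟨ ≈-+ (fermat 1 (s≤s (s≤s (s≤s z≤n)))) ≈-refl ⟩
    + 1 - + 1                 ∎)))
    where open ≈-Reasoning

  d : ℕ → ℕ
  d j = C p (suc j) / p

  p*d : ∀ j → j ℕ.< m → p ℕ.* d j ≡ C p (suc j)
  p*d j j<m = m*[n/m]≡n (p∣C j (s≤s j<m))

  [j+1]*d : ∀ j → j ℕ.< m → suc j ℕ.* d j ≡ C m j
  [j+1]*d j j<m = ℕₚ.*-cancelˡ-≡ (suc j ℕ.* d j) (C m j) p (begin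
    p ℕ.* (suc j ℕ.* d j)      ≡⟨ swap-factors p (suc j) (d j) ⟩
    suc j ℕ.* (p ℕ.* d j)      ≡⟨ cong (suc j ℕ.*_) (p*d j j<m) ⟩
    suc j ℕ.* C p (suc j)      ≡⟨ C-absorb m j ⟩
    p ℕ.* C m j                ∎)
    where
      open ≡-Reasoning
      swap-factors : ∀ a b c → a ℕ.* (b ℕ.* c) ≡ b ℕ.* (a ℕ.* c)
      swap-factors = ℕ-Ring.solve-∀

  d≈ : ∀ j → j ℕ.< m → + d j ≈ sgn j * inv (suc j)
  d≈ j j<m = begin
    + d j                                     ≡⟨ sym (ℤₚ.*-identityʳ (+ d j)) ⟩
    + d j * + 1                               ≈⟨ ≈-* (≈-refl {+ d j}) (≈-sym (inv-inverse j (s≤s j<m))) ⟩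
    + d j * (+ suc j * inv (suc j))           ≡⟨ ℤ-Ring-assoc (+ d j) (+ suc j) (inv (suc j)) ⟩
    + suc j * + d j * inv (suc j)             ≡⟨ cong (_* inv (suc j)) (trans (sym (ℤₚ.pos-* (suc j) (d j))) (cong +_ ([j+1]*d j j<m))) ⟩
    + C m j * inv (suc j)                     ≈⟨ ≈-* (C-pred≈sgn j (ℕₚ.m<n⇒m<1+n j<m)) ≈-refl ⟩
    sgn j * inv (suc j)                       ∎
    where
      open ≈-Reasoning
      ℤ-Ring-assoc : ∀ a b c → a * (b * c) ≡ b * a * c
      ℤ-Ring-assoc = solve-∀

  2^p : + (2 ℕ.^ p) ≡ + 2 + + p * ∑[ j < m ] (+ d j)
  2^p = begin
    + (2 ℕ.^ p)                                   ≡⟨ pos-^ 2 p ⟩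
    (+ 1 + + 1) ^ p                               ≡⟨ binomial-theorem (+ 1) p ⟩
    ∑ p term + term p                             ≡⟨ cong₂ _+_ (∑-front m term) (cong₂ (λ c t → + c * t) (C-diag p) (ℤₚ.^-zeroˡ p)) ⟩
    (term 0 + ∑[ j < m ] term (suc j)) + + 1 * + 1 ≡⟨ cong (λ z → (term 0 + z) + + 1 * + 1)
                                                          (trans (∑-cong m middle) (∑-* m (+ p) (λ j → + d j))) ⟩
    (+ 1 * + 1 + + p * ∑[ j < m ] (+ d j)) + + 1 * + 1 ≡⟨ tidy (+ p * ∑[ j < m ] (+ d j)) ⟩
    + 2 + + p * ∑[ j < m ] (+ d j)                  ∎
    where
      open ≡-Reasoning
      term : ℕ → ℤ
      term j = + C p j * (+ 1) ^ j
      middle : ∀ j → j ℕ.< m → term (suc j) ≡ + p * + d j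
      middle j j<m = trans (cong (+ C p (suc j) *_) (ℤₚ.^-zeroˡ (suc j)))
                       (trans (ℤₚ.*-identityʳ _) (trans (cong +_ (sym (p*d j j<m))) (ℤₚ.pos-* p (d j))))
      tidy : ∀ x → (+ 1 * + 1 + x) + + 1 * + 1 ≡ + 2 + x
      tidy = solve-∀

  -- Comparing with 2ᵖ = 2 (p q + 1):  ∑_{j < p-1} d j = 2q.
  ∑d : ∑[ j < m ] (+ d j) ≡ + 2 * + q
  ∑d = ℤₚ.*-cancelˡ-≡ (+ p) _ _ (+-cancelˡ (+ 2) (trans (sym 2^p) 2^p-via-q))
    where
      +-cancelˡ : ∀ a {x y} → a + x ≡ a + y → x ≡ y
      +-cancelˡ a {x} {y} eq = trans (add-sub a x) (trans (cong (_- a) eq) (sym (add-sub a y)))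
        where add-sub : ∀ a x → x ≡ (a + x) - a
              add-sub = solve-∀
      2^p-via-q : + (2 ℕ.^ p) ≡ + 2 + + p * (+ 2 * + q)
      2^p-via-q = begin
        + (2 ℕ.^ p)                  ≡⟨ cong (λ x → + (2 ℕ.* x)) (sym (ℕₚ.m∸n+n≡m (ℕₚ.m^n>0 2 m))) ⟩
        + (2 ℕ.* (2 ℕ.^ m ℕ.∸ 1 ℕ.+ 1)) ≡⟨ cong (λ x → + (2 ℕ.* (x ℕ.+ 1))) (sym p*q) ⟩
        + (2 ℕ.* (p ℕ.* q ℕ.+ 1))    ≡⟨ cast p q ⟩
        + 2 + + p * (+ 2 * + q)      ∎
        where
          open ≡-Reasoning
          cast : ∀ a b → + (2 ℕ.* (a ℕ.* b ℕ.+ 1)) ≡ + 2 + + a * (+ 2 * + b)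
          cast a b = trans (ℤₚ.pos-* 2 (a ℕ.* b ℕ.+ 1)) (trans (cong (+ 2 *_) (trans (ℤₚ.pos-+ (a ℕ.* b) 1)
                       (cong (_+ + 1) (ℤₚ.pos-* a b)))) (expand (+ a) (+ b)))
            where expand : ∀ a b → + 2 * (a * b + + 1) ≡ + 2 + a * (+ 2 * b)
                  expand = solve-∀

  -- q ≡ ∑_{k odd, k < p} 1/k:  2q ≡ ∑_j (-1)ʲ/(j+1) = O - E, and O + E = H(p-1) ≡ 0.
  q≈odd-sum : + q ≈ odd-sum s
  q≈odd-sum = halve (begin
    + 2 * + q                                    ≡⟨ sym ∑d ⟩
    ∑[ j < m ] (+ d j)                           ≈⟨ ≈-∑ m d≈ ⟩
    ∑[ j < m ] (sgn j * inv (suc j))             ≡⟨ ∑-pairs (suc s) (λ j → sgn j * inv (suc j)) ⟩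
    ∑[ i < suc s ] (sgn (double i) * O i + sgn (suc (double i)) * E i)
                                                 ≡⟨ ∑-cong (suc s) (λ i _ → alternate i) ⟩
    ∑[ i < suc s ] (O i + - E i)                 ≡⟨ trans (∑-+ (suc s) O (λ i → - E i)) (cong (_+_ (odd-sum s)) (∑-neg (suc s) E)) ⟩
    odd-sum s - ∑ (suc s) E                      ≡⟨ regroup (odd-sum s) (∑ (suc s) E) ⟩
    + 2 * odd-sum s - (odd-sum s + ∑ (suc s) E)  ≡⟨ cong (λ z → + 2 * odd-sum s - z) (sym H-split) ⟩
    + 2 * odd-sum s - H m                        ≈⟨ ≈-+ (≈-refl {+ 2 * odd-sum s}) (≈-neg H-full) ⟩
    + 2 * odd-sum s - + 0                        ≡⟨ ℤₚ.+-identityʳ (+ 2 * odd-sum s) ⟩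
    + 2 * odd-sum s                              ∎)
    where
      open ≈-Reasoning
      O E : ℕ → ℤ
      O i = inv (suc (double i))
      E i = inv (suc (suc (double i)))
      alternate : ∀ i → sgn (double i) * O i + sgn (suc (double i)) * E i ≡ O i + - E i
      alternate i = trans (cong (λ σ → σ * O i + -[1+ 0 ] * σ * E i) (sgn-even i)) (signs (O i) (E i))
        where signs : ∀ a b → + 1 * a + -[1+ 0 ] * + 1 * b ≡ a + - b
              signs = solve-∀
      H-split : H m ≡ odd-sum s + ∑ (suc s) E
      H-split = trans (∑-pairs (suc s) (inv ∘ suc)) (∑-+ (suc s) O E)
      regroup : ∀ O E → O - E ≡ + 2 * O - (O + E)
      regroup = solve-∀

  even-indicator-even : ∀ t → even-indicator (double t) ≡ + 1
  even-indicator-even t rewrite dec-true (2 ∣? double t) (even-double t) = refl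

  even-indicator-odd : ∀ t → even-indicator (suc (double t)) ≡ + 0
  even-indicator-odd t rewrite dec-false (2 ∣? suc (double t)) (odd-double t) = refl

  eulerian-sum-even : eulerian-sum n even-indicator ≡ ∑[ i < suc s ] explicit n (double i)
  eulerian-sum-even =
    trans (∑-pairs (suc s) (λ k → A n k * even-indicator k))
          (∑-cong (suc s) (λ i _ → trans (cong₂ (λ u v → A n (double i) * u + A n (suc (double i)) * v)
                                                (even-indicator-even i) (even-indicator-odd i))
                                         (trans (keep-first (A n (double i)) (A n (suc (double i)))) (A≡explicit n (double i)))))
    where keep-first : ∀ x y → x * + 1 + y * + 0 ≡ x
          keep-first = solve-∀

  module _ (L : List (List ℕ)) (L-unique : Unique L)
           (L-spec : ∀ xs → xs ∈ L ⇔ ((xs ↭ upTo n) × (2 ∣ ascents xs) × (xs ≢ upTo n))) where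

    count≈ : + suc (length L) ≈ H-odd-sum s
    count≈ = begin
      + suc (length L)                                  ≡⟨ cong +_ (count-even-perms n L L-unique L-spec identity-even) ⟩
      + length (filter has-even-ascents (perms n))      ≡⟨ count-even (perms n) ⟩
      ascent-sum (perms n) even-indicator               ≡⟨ ascent-distribution n even-indicator ⟩
      eulerian-sum n even-indicator                     ≡⟨ eulerian-sum-even ⟩
      ∑[ i < suc s ] explicit n (double i)              ≈⟨ ≈-∑ (suc s) (λ i i<s+1 → explicit≈H (double i) (bound i<s+1)) ⟩
      H-odd-sum s                                       ∎
      where
        open ≈-Reasoning
        identity-even : 2 ∣ ascents (upTo n)
        identity-even = subst (2 ∣_) (sym (ascents-upTo (double s))) (even-double s)
        bound : ∀ {i} → i ℕ.< suc s → suc (double i) ℕ.< p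
        bound (s≤s i≤s) = s≤s (s≤s (ℕₚ.m≤n⇒m≤1+n (double-mono i≤s)))

    2L+1≈odd-sum : + (2 ℕ.* length L ℕ.+ 1) ≈ odd-sum s
    2L+1≈odd-sum = begin
      + (2 ℕ.* length L ℕ.+ 1)                    ≡⟨ trans (ℤₚ.pos-+ (2 ℕ.* length L) 1) (cong (_+ + 1) (ℤₚ.pos-* 2 (length L))) ⟩
      + 2 * + length L + + 1                      ≡⟨ halve-out (+ length L) ⟩
      + 2 * (+ 1 + + length L) - + 1              ≡⟨ cong (λ z → + 2 * z - + 1) (sym (ℤₚ.pos-+ 1 (length L))) ⟩
      + 2 * + suc (length L) - + 1                ≈⟨ ≈-+ (≈-* (≈-refl {+ 2}) count≈) ≈-refl ⟩
      + 2 * H-odd-sum s - + 1                     ≈⟨ H-odd-sum≈ ⟩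
      odd-sum s                                   ∎
      where
        open ≈-Reasoning
        halve-out : ∀ x → + 2 * x + + 1 ≡ + 2 * (+ 1 + x) - + 1
        halve-out = solve-∀

  -- ∑_{j ≤ k, j odd} j⁻¹ in ℤ, mirroring `oddHarmonic`.
  odd-inverse-sum : ℕ → ℤ
  odd-inverse-sum zero    = + 0
  odd-inverse-sum (suc k) = odd-inverse-sum k + (if does (2 ∣? suc k) then + 0 else inv (suc k))

  residue-oddHarmonic : ∀ k → k ℕ.< p → HasResidue (oddHarmonic k) (odd-inverse-sum k)
  residue-oddHarmonic zero    _   = residue-int (+ 0)
  residue-oddHarmonic (suc k) k<p with does (2 ∣? suc k)
  ... | true  = residue-+ (residue-oddHarmonic k (ℕₚ.<-trans (ℕₚ.n<1+n k) k<p)) (residue-int (+ 0))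
  ... | false = residue-+ (residue-oddHarmonic k (ℕₚ.<-trans (ℕₚ.n<1+n k) k<p))
                          (residue-inverse k (∤-below k k<p) (≈-trans (≈-reflexive (ℤₚ.*-comm (inv (suc k)) (+ suc k)))
                                                                          (inv-inverse k k<p)))

  odd-inverse-sum-double : ∀ t → odd-inverse-sum (double t) ≡ ∑[ i < t ] inv (suc (double i))
  odd-inverse-sum-double zero    = refl
  odd-inverse-sum-double (suc t)
    rewrite dec-false (2 ∣? suc (double t)) (odd-double t) | dec-true (2 ∣? suc (suc (double t))) (even-double (suc t)) =
    trans (ℤₚ.+-identityʳ _) (cong (_+ inv (suc (double t))) (odd-inverse-sum-double t))

  residue-fermat-quotient : HasResidue (fermatQuotient2 p pr) (+ q)
  residue-fermat-quotient =
    residue (+ q) 0 (ℚᵘₚ.≃-trans (ℚₚ.toℚᵘ-fromℚᵘ (mkℚᵘ (+ (2 ℕ.^ m ℕ.∸ 1)) m)) (*≡* cross))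
            (∤-below 0 (s≤s (s≤s z≤n))) (≈-reflexive (sym (ℤₚ.*-identityʳ (+ q))))
    where
      cross : + (2 ℕ.^ m ℕ.∸ 1) * + 1 ≡ + q * + p
      cross = trans (ℤₚ.*-identityʳ _) (trans (cong +_ (trans (sym p*q) (ℕₚ.*-comm p q))) (ℤₚ.pos-* q p))

  fermat-quotient-congruence : fermatQuotient2 p pr ≡ oddHarmonic m [modℚ p ]
  fermat-quotient-congruence =
    residue-zero (residue-− residue-fermat-quotient (residue-oddHarmonic m ℕₚ.≤-refl)) (begin
      + q - odd-inverse-sum m      ≡⟨ cong (λ z → + q - z) (odd-inverse-sum-double (suc s)) ⟩
      + q - odd-sum s              ≈⟨ ≈-+ q≈odd-sum ≈-refl ⟩
      odd-sum s - odd-sum s        ≡⟨ ℤₚ.+-inverseʳ (odd-sum s) ⟩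
      + 0                          ∎)
    where open ≈-Reasoning

  even-ascent-congruence : ∀ (L : List (List ℕ)) → Unique L →
    (∀ xs → xs ∈ L ⇔ ((xs ↭ upTo n) × (2 ∣ ascents xs) × (xs ≢ upTo n))) →
    oddHarmonic m ≡ (+ (2 ℕ.* length L ℕ.+ 1)) ℚ./ 1 [modℚ p ]
  even-ascent-congruence L L-unique L-spec =
    residue-zero (residue-− (residue-oddHarmonic m ℕₚ.≤-refl) (residue-int (+ (2 ℕ.* length L ℕ.+ 1)))) (begin
      odd-inverse-sum m - + (2 ℕ.* length L ℕ.+ 1) ≡⟨ cong (_- + (2 ℕ.* length L ℕ.+ 1)) (odd-inverse-sum-double (suc s)) ⟩
      odd-sum s - + (2 ℕ.* length L ℕ.+ 1)         ≈⟨ ≈-+ (≈-refl {odd-sum s}) (≈-neg (2L+1≈odd-sum L L-unique L-spec)) ⟩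
      odd-sum s - odd-sum s                        ≡⟨ ℤₚ.+-inverseʳ (odd-sum s) ⟩
      + 0                                          ∎)
    where open ≈-Reasoning

odd-prime-form : ∀ {p} → Prime p → p ≢ 2 → ∃[ s ] p ≡ suc (suc (suc (double s)))
odd-prime-form {zero}                  pr _   = ⊥-elim (¬prime[0] pr)
odd-prime-form {suc zero}              pr _   = ⊥-elim (¬prime[1] pr)
odd-prime-form {suc (suc zero)}        _  p≢2 = ⊥-elim (p≢2 refl)
odd-prime-form {suc (suc (suc k))}     pr _   with parity k
... | inj₁ (s , refl) = s , refl
... | inj₂ (s , refl) with prime⇒irreducible pr {2} (even-double (suc (suc s)))
...   | inj₁ ()
...   | inj₂ ()

theorem3 : (p : ℕ) → (pr : Prime p) → p ≢ 2 →
    (L : List (List ℕ)) → Unique L →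
    (∀ xs → xs ∈ L ⇔ ((xs ↭ upTo (p ℕ.∸ 2)) × (2 ∣ ascents xs) × (xs ≢ upTo (p ℕ.∸ 2)))) →
    (fermatQuotient2 p pr ≡ oddHarmonic (p ℕ.∸ 1) [modℚ p ])
      × (oddHarmonic (p ℕ.∸ 1) ≡ (+ (2 ℕ.* length L ℕ.+ 1)) ℚ./ 1 [modℚ p ])
theorem3 p pr p≢2 L L-unique L-spec with odd-prime-form pr p≢2
... | s , refl = fermat-quotient-congruence , even-ascent-congruence L L-unique L-spec
  where open OddPrime s pr
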